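{- Let $\mathcal{M}=\langle W,\leq,\mathbf{v},D,\phi\rangle$ be a G-model with base point $\mathbf{v}$ interpreting unary predicate symbols $P,Q$, and let $$\Gamma = \forall x\, \exists y\, (Py \wedge (Qy \rightarrow Rx)) \wedge \neg \forall x\, Rx,\qquad \Delta = \forall x\,(Px \rightarrow (Qx \vee S)) \rightarrow S,$$ with $R$ a unary and $S$ a $0$-ary predicate variable. Then: 1. $\mathbf{v}\Vdash\exists R\,\Gamma$ if and only if $\mathcal{M}$ satisfies the condition $I(P,Q)$: for every $w\in W$ there is $a\in D$ with $\mathbf{v}\Vdash Pa$ and $w\not\Vdash Qa$. 2. $\mathbf{v}\Vdash\forall S\,\Delta$ if and only if $\mathcal{M}$ satisfies the condition $J(P,Q)$: for every $w\in W$ there is $a\in D$ with $w\Vdash Pa$ and $w\not\Vdash Qa$.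
   Context: A G-model is a structure $\langle W,\leq,\mathbf{v},D,\phi\rangle$ where $W$ is a non-empty set, $\leq$ is a reflexive transitive relation on $W$, $\mathbf{v}\leq u$ for all $u\in W$, $D$ is a non-empty set, and for each $k$-ary predicate symbol $P$, $\phi(P)\subseteq W\times D^k$ is monotone: if $u\leq w$ and $\langle u,\vec a\rangle\in\phi(P)$ then $\langle w,\vec a\rangle\in\phi(P)$. Forcing: $u\Vdash P\vec a$ iff $\langle u,\vec a\rangle\in\phi(P)$; $\wedge,\vee$ locally; $u\Vdash A\rightarrow B$ iff for all $w\geq u$, $w\Vdash A$ implies $w\Vdash B$; $\perp$ never forced; $\neg A:=A\rightarrow\perp$; $u\Vdash\exists xA$ (resp. $\forall xA$) iff $u\Vdash A[a/x]$ for some (resp. all) $a\in D$. Second-order semantics: $u\Vdash\exists R\,\Gamma$ iff there is a monotone $R\subseteq W\times D$ such that $u$ forces $\Gamma$ in the model expanded by this interpretation of $R$; $u\Vdash\forall S\,\Delta$ iff for every upward closed $S\subseteq W$ (interpretation of the propositional variable $S$), $u$ forces $\Delta$ in the expanded model. -}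

module Defs where

open import Level using (Level; suc; _⊔_)
open import Data.Product using (Σ; _×_; ∃)
open import Data.Sum using (_⊎_)
open import Data.Empty.Polymorphic using (⊥)
open import Relation.Nullary using (¬_)

-- A G-model interpreting the unary predicate symbols P and Q
-- (interpretations of other symbols play no role in the statement).
record GModel (ℓ : Level) : Set (suc ℓ) where
  field
    W      : Set ℓ
    _≤_    : W → W → Set ℓ
    ≤-refl  : ∀ u → u ≤ u
    ≤-trans : ∀ {u w z} → u ≤ w → w ≤ z → u ≤ z
    v      : W
    v≤     : ∀ u → v ≤ u
    D      : Set ℓ
    d₀     : D
    P      : W → D → Set ℓ          -- u ⊩ P a  iff  ⟨u,a⟩ ∈ φ(P)
    Q      : W → D → Set ℓ
    P-mono : ∀ {u w a} → u ≤ w → P u a → P w a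
    Q-mono : ∀ {u w a} → u ≤ w → Q u a → Q w a

module Forcing {ℓ : Level} (M : GModel ℓ) where
  open GModel M

  _⇒_ : (W → Set ℓ) → (W → Set ℓ) → W → Set ℓ
  (A ⇒ B) u = ∀ w → u ≤ w → A w → B w

  ¬ₖ : (W → Set ℓ) → W → Set ℓ
  ¬ₖ A = A ⇒ (λ _ → ⊥)

  Monotone : (W → D → Set ℓ) → Set ℓ
  Monotone R = ∀ {u w a} → u ≤ w → R u a → R w a

  UpClosed : (W → Set ℓ) → Set ℓ
  UpClosed S = ∀ {u w} → u ≤ w → S u → S w

  ForcesΓ : (R : W → D → Set ℓ) → W → Set ℓ
  ForcesΓ R u =
    (∀ (x : D) → Σ D (λ y → P u y × ((λ w → Q w y) ⇒ (λ w → R w x)) u))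
    × ¬ₖ (λ w → ∀ (x : D) → R w x) u

  ForcesΔ : (S : W → Set ℓ) → W → Set ℓ
  ForcesΔ S = (λ w → ∀ (x : D) → ((λ z → P z x) ⇒ (λ z → Q z x ⊎ S z)) w) ⇒ S

  Forces∃RΓ : Set (suc ℓ)
  Forces∃RΓ = Σ (W → D → Set ℓ) (λ R → Monotone R × ForcesΓ R v)

  Forces∀SΔ : Set (suc ℓ)
  Forces∀SΔ = ∀ (S : W → Set ℓ) → UpClosed S → ForcesΔ S v

  I : Set ℓ
  I = ∀ (w : W) → Σ D (λ a → P v a × ¬ Q w a)

  J : Set ℓ
  J = ∀ (w : W) → Σ D (λ a → P w a × ¬ Q w a)

-- classical metatheory (the paper reasons classically about models)
ExcludedMiddle : (ℓ : Level) → Set (suc ℓ)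
ExcludedMiddle ℓ = ∀ (A : Set ℓ) → A ⊎ ¬ A

module Submission where

-- Part 1.  (⇒) Given a monotone R with v ⊩ Γ, at any world w the conjunct
-- ¬∀x Rx yields an x with w ⊮ Rx; the witness y for x in ∀x∃y(...) then has
-- v ⊩ Py, and w ⊮ Qy because Qy → Rx is forced at v.  (⇐) Given I, the
-- relation  w ⊩ Rx :⇔ (v ⊩ Px ⇒ w ⊩ Qx)  is monotone and realises Γ at v.
--
-- Part 2.  (⇒) Given v ⊩ ∀S Δ and a world w, instantiate S with the upward
-- closed set of worlds not below w; if J failed at w, the premise of Δ would
-- be forced at w, so S would hold at w, which is absurd.  (⇐) Given J, the
-- element a provided at w refutes the left disjunct of the premise of Δ,
-- so the right disjunct S must hold at w.

open import Defs
open import Level using (Level; lower)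
open import Data.Product using (_×_; _,_; Σ; proj₁; proj₂)
open import Data.Sum using (_⊎_; inj₁; inj₂)
open import Data.Empty using (⊥-elim)
open import Function.Bundles using (_⇔_; mk⇔)
open import Relation.Nullary using (¬_)

module Classical {ℓ : Level} (em : ExcludedMiddle ℓ) where

  stable : {A : Set ℓ} → ¬ ¬ A → A
  stable {A} ¬¬a with em A
  ... | inj₁ a  = a
  ... | inj₂ ¬a = ⊥-elim (¬¬a ¬a)

  ¬∀⇒∃¬ : {D : Set ℓ} {B : D → Set ℓ} → ¬ (∀ x → B x) → Σ D (λ x → ¬ B x)
  ¬∀⇒∃¬ ¬∀ = stable λ ¬∃ → ¬∀ λ x → stable λ ¬b → ¬∃ (x , ¬b)

module _ {ℓ : Level} (M : GModel ℓ) where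
  open GModel M
  open Forcing M

  ¬ₖ-at-root : {A : W → Set ℓ} → ¬ₖ A v → ∀ w → ¬ A w
  ¬ₖ-at-root ¬A w a = lower (¬A w (v≤ w) a)

  J⇒Δ : J → ∀ (S : W → Set ℓ) u → ForcesΔ S u
  J⇒Δ j S u w _ premise with j w
  ... | (a , pa , ¬qa) with premise a w (≤-refl w) pa
  ...   | inj₁ qa = ⊥-elim (¬qa qa)
  ...   | inj₂ s  = s

  NotBelow : W → W → Set ℓ
  NotBelow w z = ¬ (z ≤ w)

  NotBelow-upClosed : ∀ w → UpClosed (NotBelow w)
  NotBelow-upClosed w u≤z z≰w u≤w = z≰w (≤-trans u≤z u≤w)

  module _ (em : ExcludedMiddle ℓ) where
    open Classical em

    -- Part 1 (⇒): the witnesses y of Γ, taken for a counterexample x to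
    -- ∀x Rx at w, are the elements required by I at w.
    Γ⇒I : Forces∃RΓ → I
    Γ⇒I (R , _ , witnesses , ¬∀R) w
      with ¬∀⇒∃¬ (¬ₖ-at-root {λ z → ∀ x → R z x} ¬∀R w)
    ... | (x , ¬Rwx) with witnesses x
    ...   | (y , pvy , qy⇒rx) = y , pvy , λ qwy → ¬Rwx (qy⇒rx w (v≤ w) qwy)

    Rᴵ : W → D → Set ℓ
    Rᴵ w x = P v x → Q w x

    Rᴵ-monotone : Monotone Rᴵ
    Rᴵ-monotone u≤w r pvx = Q-mono u≤w (r pvx)

    -- First conjunct of Γ: take y = x when v ⊩ Px (then Qx → Rx is immediate);
    -- otherwise Rx holds vacuously, and any P-element at v serves as y.
    Rᴵ-witnesses : Σ D (P v) → ∀ x → Σ D (λ y → P v y × ((λ w → Q w y) ⇒ (λ w → Rᴵ w x)) v)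
    Rᴵ-witnesses _ x with em (P v x)
    Rᴵ-witnesses _ x | inj₁ pvx = x , pvx , λ _ _ qwx _ → qwx
    Rᴵ-witnesses (y , pvy) x | inj₂ ¬pvx = y , pvy , λ _ _ _ pvx → ⊥-elim (¬pvx pvx)

    Rᴵ-not-total : I → ¬ₖ (λ w → ∀ x → Rᴵ w x) v
    Rᴵ-not-total i w _ all with i w
    ... | (a , pva , ¬qwa) = ⊥-elim (¬qwa (all a pva))

    I⇒Γ : I → Forces∃RΓ
    I⇒Γ i = Rᴵ , Rᴵ-monotone , Rᴵ-witnesses P-element , Rᴵ-not-total i
      where
      P-element : Σ D (P v)
      P-element = proj₁ (i v) , proj₁ (proj₂ (i v))

    -- If J fails at w then, with S = NotBelow w, the premise of Δ is forced
    -- at w: a world z ≥ w forcing Px is either not below w, or equivalent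
    -- to w, where Px forces Qx by the failure of J.
    ¬J⇒premise : ∀ w → ¬ Σ D (λ a → P w a × ¬ Q w a) →
                 ∀ x → ((λ z → P z x) ⇒ (λ z → Q z x ⊎ NotBelow w z)) w
    ¬J⇒premise w ¬j x z w≤z pzx with em (z ≤ w)
    ... | inj₂ z≰w = inj₂ z≰w
    ... | inj₁ z≤w = inj₁ (Q-mono w≤z (stable λ ¬qwx → ¬j (x , P-mono z≤w pzx , ¬qwx)))

    -- Part 2 (⇒): otherwise Δ would force NotBelow w at w itself.
    Δ⇒J : Forces∀SΔ → J
    Δ⇒J δ w = stable λ ¬j →
      δ (NotBelow w) (NotBelow-upClosed w) w (v≤ w) (¬J⇒premise w ¬j) (≤-refl w)

lemma3p2 : ∀ {ℓ : Level} → ExcludedMiddle ℓ → (M : GModel ℓ) →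
    let open Forcing M in
    (Forces∃RΓ ⇔ I) × (Forces∀SΔ ⇔ J)
lemma3p2 em M =
  mk⇔ (Γ⇒I M em) (I⇒Γ M em) ,
  mk⇔ (Δ⇒J M em) (λ j S _ → J⇒Δ M j S (GModel.v M))
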